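{- Any cubic graph has a spanning maximum $2$-edge-colorable subgraph.
   Context: Graphs are finite, undirected, without loops, possibly with multiple edges; a cubic graph is a $3$-regular graph. A subgraph $H$ of $G$ is spanning if every vertex of $G$ has degree at least $1$ in $H$. A maximum $2$-edge-colorable subgraph of $G$ is a subgraph whose edge set is a union of two matchings and which has the maximum possible number of edges among such subgraphs. -}

module Defs where

open import Data.Nat using (ℕ; _≤_)
open import Data.Fin using (Fin; _≟_)
open import Data.Fin.Subset using (Subset; _∈_; ∣_∣)
open import Data.Bool using (Bool; _∨_)
open import Data.Vec using (tabulate)
open import Data.Product using (_×_; _,_; proj₁; proj₂; Σ; ∃)
open import Relation.Nullary using (¬_)
open import Relation.Nullary.Decidable using (⌊_⌋)
open import Relation.Binary.PropositionalEquality using (_≡_)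

-- A finite multigraph without loops: vertices Fin n, edges Fin m,
-- each edge has two distinct endpoints. Parallel edges are allowed.
record Graph : Set where
  field
    n     : ℕ
    m     : ℕ
    ends  : Fin m → Fin n × Fin n
    noLoop : ∀ e → ¬ (proj₁ (ends e) ≡ proj₂ (ends e))

open Graph public

incident : (G : Graph) → Fin (n G) → Fin (m G) → Set
incident G v e = (v ≡ proj₁ (ends G e)) Data.Sum.⊎ (v ≡ proj₂ (ends G e))
  where import Data.Sum

incidentEdges : (G : Graph) → Fin (n G) → Subset (m G)
incidentEdges G v = tabulate λ e → ⌊ v ≟ proj₁ (ends G e) ⌋ ∨ ⌊ v ≟ proj₂ (ends G e) ⌋

-- degree (no loops, so each incident edge counts once)
degree : (G : Graph) → Fin (n G) → ℕ
degree G v = ∣ incidentEdges G v ∣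

Cubic : Graph → Set
Cubic G = ∀ v → degree G v ≡ 3

Adjacent : (G : Graph) → Fin (m G) → Fin (m G) → Set
Adjacent G e f = ∃ λ v → incident G v e × incident G v f

IsMatching : (G : Graph) → Subset (m G) → Set
IsMatching G M = ∀ e f → e ∈ M → f ∈ M → ¬ (e ≡ f) → ¬ Adjacent G e f

TwoEdgeColorable : (G : Graph) → Subset (m G) → Set
TwoEdgeColorable G H =
  Σ (Subset (m G)) λ M₁ → Σ (Subset (m G)) λ M₂ →
    IsMatching G M₁ × IsMatching G M₂ ×
    (∀ e → e ∈ H → (e ∈ M₁) Data.Sum.⊎ (e ∈ M₂)) ×
    (∀ e → e ∈ M₁ → e ∈ H) × (∀ e → e ∈ M₂ → e ∈ H)
  where import Data.Sum

IsMax2EdgeColorable : (G : Graph) → Subset (m G) → Set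
IsMax2EdgeColorable G H =
  TwoEdgeColorable G H × (∀ H' → TwoEdgeColorable G H' → ∣ H' ∣ ≤ ∣ H ∣)

Spanning : (G : Graph) → Subset (m G) → Set
Spanning G H = ∀ v → ∃ λ e → e ∈ H × incident G v e

module Submission where

-- A 2-edge-colourable subgraph is the same as a proper partial colouring of
-- the edges with red and blue.  Among proper colourings choose an optimal one:
-- first as many coloured edges as possible, then as many covered vertices as
-- possible (optimal-exists, by finite maximisation).  Suppose a vertex v is
-- uncovered.  Each neighbour y of v then sees both colours (augment), and
-- moving the colour of an edge f = ya onto vy ("rotation") gives another
-- optimal colouring in which a is uncovered.  Induction along walks,
-- rotating at every step, shows that all neighbours of every vertex reached
-- from v by an even walk are saturated (even-walk-saturated).  Then the hops
-- "uncoloured edge, then red edge", started at v, visit pairwise distinct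
-- vertices forever (NoUncoveredVertex), which is impossible in a finite graph.

open import Defs
open import Data.Bool using (Bool; true; false; _∧_; _∨_; not; if_then_else_) renaming (_≟_ to _≟ᵇ_)
open import Data.Bool.Properties using (∧-identityʳ; ∧-zeroʳ)
open import Data.Empty using (⊥; ⊥-elim)
open import Data.Fin using (Fin; zero; suc; _≟_; toℕ)
open import Data.Fin.Properties using (any?; all?; pigeonhole; toℕ-injective; <⇒≢)
  renaming (suc-injective to fsuc-injective)
open import Data.Fin.Subset using (Subset; _∈_; ∣_∣)
open import Data.Fin.Subset.Properties using (_∈?_)
open import Data.Maybe using (Maybe; just; nothing; is-just)
open import Data.Maybe.Properties using (just-injective)
import Data.Maybe.Properties as Maybe
open import Data.Nat using (ℕ; zero; suc; _+_; _*_; _≤_; _<_; z≤n; s≤s; _≤?_)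
open import Data.Nat.Properties
  using (≤-refl; ≤-trans; ≤-reflexive; ≤-pred; ≰⇒≥; ≰⇒>; <⇒≱; m≤n⇒m≤1+n; suc-injective; 1+n≰n;
         n<1+n; +-comm; m≤m+n; +-monoʳ-≤; +-monoʳ-<; *-monoˡ-≤; module ≤-Reasoning)
open import Data.Product using (Σ; ∃; _×_; _,_; proj₁; proj₂)
open import Data.Sum using (_⊎_; inj₁; inj₂)
open import Data.Vec using ([]; _∷_; tabulate; lookup)
open import Data.Vec.Functional using () renaming (_∷_ to _∷ᶠ_)
open import Data.Vec.Properties using (lookup∘tabulate; []=⇒lookup; lookup⇒[]=)
open import Function using (_∘_)
open import Function.Bundles using (mk⇔)
open import Relation.Nullary using (¬_; Dec; yes; no; does; _×-dec_; _→-dec_)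
open import Relation.Nullary.Decidable using (⌊_⌋; map′; dec-true; dec-false; does-⇔)
open import Relation.Binary.PropositionalEquality
open import Relation.Binary.Construct.Closure.ReflexiveTransitive using (Star; ε; _◅_; _◅◅_)

_⊆_ : ∀ {k} → (Fin k → Bool) → (Fin k → Bool) → Set
f ⊆ g = ∀ i → f i ≡ true → g i ≡ true

count : ∀ {k} → (Fin k → Bool) → ℕ
count {zero}  f = 0
count {suc k} f = if f zero then suc (count (f ∘ suc)) else count (f ∘ suc)

∣∣≡count : ∀ {k} (p : Subset k) → ∣ p ∣ ≡ count (lookup p)
∣∣≡count []          = refl
∣∣≡count (true ∷ p)  = cong suc (∣∣≡count p)
∣∣≡count (false ∷ p) = ∣∣≡count p

count-cong : ∀ {k} {f g : Fin k → Bool} → f ≗ g → count f ≡ count g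
count-cong {zero}      eq = refl
count-cong {suc k} {f} {g} eq rewrite eq zero with g zero
... | true  = cong suc (count-cong (eq ∘ suc))
... | false = count-cong (eq ∘ suc)

count-≤ : ∀ {k} (f : Fin k → Bool) → count f ≤ k
count-≤ {zero}  f = z≤n
count-≤ {suc k} f with f zero
... | true  = s≤s (count-≤ (f ∘ suc))
... | false = m≤n⇒m≤1+n (count-≤ (f ∘ suc))

count-mono : ∀ {k} {f g : Fin k → Bool} → f ⊆ g → count f ≤ count g
count-mono {zero}          f⊆g = z≤n
count-mono {suc k} {f} {g} f⊆g with f zero in f₀ | g zero in g₀
... | true  | true  = s≤s (count-mono (f⊆g ∘ suc))
... | false | true  = m≤n⇒m≤1+n (count-mono (f⊆g ∘ suc))
... | false | false = count-mono (f⊆g ∘ suc)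
... | true  | false with () ← trans (sym (f⊆g zero f₀)) g₀

count-add : ∀ {k} {f g : Fin k → Bool} {i} → f i ≡ false → g i ≡ true →
            (∀ j → j ≢ i → f j ≡ g j) → count g ≡ suc (count f)
count-add {suc k} {f} {g} {zero} fi gi rest
  rewrite fi | gi = cong suc (count-cong (λ j → sym (rest (suc j) λ ())))
count-add {suc k} {f} {g} {suc i} fi gi rest
  rewrite rest zero (λ ()) with g zero
... | true  = cong suc (count-add fi gi (λ j j≢i → rest (suc j) (j≢i ∘ fsuc-injective)))
... | false = count-add fi gi (λ j j≢i → rest (suc j) (j≢i ∘ fsuc-injective))

remove : ∀ {k} → (Fin k → Bool) → Fin k → Fin k → Bool
remove f i j = f j ∧ not ⌊ j ≟ i ⌋

remove-self : ∀ {k} (f : Fin k → Bool) i → remove f i i ≡ false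
remove-self f i with i ≟ i
... | yes _   = ∧-zeroʳ (f i)
... | no i≢i  with () ← i≢i refl

remove-other : ∀ {k} (f : Fin k → Bool) {i j} → j ≢ i → remove f i j ≡ f j
remove-other f {i} {j} j≢i with j ≟ i
... | yes j≡i with () ← j≢i j≡i
... | no _    = ∧-identityʳ (f j)

remove-member : ∀ {k} (f : Fin k → Bool) {i j} → remove f i j ≡ true → f j ≡ true × j ≢ i
remove-member f {i} {j} p with j ≟ i
... | no j≢i = trans (sym (∧-identityʳ (f j))) p , j≢i
... | yes _  with () ← trans (sym (∧-zeroʳ (f j))) p

count-remove : ∀ {k} (f : Fin k → Bool) {i} → f i ≡ true → count f ≡ suc (count (remove f i))
count-remove f {i} fi = count-add (remove-self f i) fi (λ j j≢i → remove-other f j≢i)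

count-pos : ∀ {k} (f : Fin k → Bool) {i} → f i ≡ true → 0 < count f
count-pos f fi rewrite count-remove f fi = s≤s z≤n

count-strict : ∀ {k} {f g : Fin k → Bool} {i} → f ⊆ g → g i ≡ true → f i ≡ false →
               count f < count g
count-strict {f = f} {g} {i} f⊆g gi fi rewrite count-remove g gi = s≤s (count-mono f⊆g-i)
  where
  f⊆g-i : f ⊆ remove g i
  f⊆g-i j fj = trans (remove-other g j≢i) (f⊆g j fj)
    where
    j≢i : j ≢ i
    j≢i refl with () ← trans (sym fi) fj

count-exchange : ∀ {k} {f g : Fin k → Bool} {a i} → (∀ j → j ≢ a → f j ≡ true → g j ≡ true) →
                 g i ≡ true → f i ≡ false → count f ≤ count g
count-exchange {f = f} {g} {a} {i} f⊆g∪a gi fi with f a in fa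
... | true  rewrite count-remove f fa = count-strict f-a⊆g gi (trans (remove-other f i≢a) fi)
  where
  f-a⊆g : remove f a ⊆ g
  f-a⊆g j p = let fj , j≢a = remove-member f p in f⊆g∪a j j≢a fj
  i≢a : i ≢ a
  i≢a refl with () ← trans (sym fi) fa
... | false = count-mono f⊆g
  where
  f⊆g : f ⊆ g
  f⊆g j fj with j ≟ a
  ... | yes refl with () ← trans (sym fa) fj
  ... | no j≢a  = f⊆g∪a j j≢a fj

count-witness : ∀ {k} (f : Fin k → Bool) → 0 < count f → ∃ λ i → f i ≡ true
count-witness {suc k} f pos with f zero in f₀
... | true  = zero , f₀
... | false = let i , fi = count-witness (f ∘ suc) pos in suc i , fi

peel : ∀ {k} (f : Fin k → Bool) {r} → count f ≡ suc r → ∃ λ i → f i ≡ true × count (remove f i) ≡ r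
peel f {r} eq with count-witness f (subst (0 <_) (sym eq) (s≤s z≤n))
... | i , fi = i , fi , suc-injective (trans (sym (count-remove f fi)) eq)

record ThreeMembers {k} (f : Fin k → Bool) : Set where
  field
    i₁ i₂ i₃    : Fin k
    i₁∈ : f i₁ ≡ true
    i₂∈ : f i₂ ≡ true
    i₃∈ : f i₃ ≡ true
    i₁≢i₂ : i₁ ≢ i₂
    i₁≢i₃ : i₁ ≢ i₃
    i₂≢i₃ : i₂ ≢ i₃

-- Kept opaque: users only need the three members, and unfolding the
-- proof (which searches the set) would make later case analyses expensive.
opaque
  threeMembers : ∀ {k} (f : Fin k → Bool) → count f ≡ 3 → ThreeMembers f
  threeMembers f eq with peel f eq
  ... | i₁ , i₁∈ , eq₁ with peel (remove f i₁) eq₁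
  ... | i₂ , i₂∈′ , eq₂ with peel (remove (remove f i₁) i₂) eq₂
  ... | i₃ , i₃∈″ , _ =
    let i₂∈ , i₂≢i₁ = remove-member f i₂∈′
        i₃∈′ , i₃≢i₂ = remove-member (remove f i₁) i₃∈″
        i₃∈ , i₃≢i₁ = remove-member f i₃∈′
    in record { i₁ = i₁ ; i₂ = i₂ ; i₃ = i₃ ; i₁∈ = i₁∈ ; i₂∈ = i₂∈ ; i₃∈ = i₃∈
              ; i₁≢i₂ = i₂≢i₁ ∘ sym ; i₁≢i₃ = i₃≢i₁ ∘ sym ; i₂≢i₃ = i₃≢i₂ ∘ sym }

noFourMembers : ∀ {k} (f : Fin k → Bool) → count f ≡ 3 → ∀ {a b c d} →
  f a ≡ true → f b ≡ true → f c ≡ true → f d ≡ true →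
  a ≢ b → a ≢ c → a ≢ d → b ≢ c → b ≢ d → c ≢ d → ⊥
noFourMembers {k} f eq {a} {b} {c} {d} fa fb fc fd a≢b a≢c a≢d b≢c b≢d c≢d = 1+n≰n (subst (0 <_) eq₃ d∈₃)
  where
  f₁ f₂ f₃ : Fin k → Bool
  f₁ = remove f a
  f₂ = remove f₁ b
  f₃ = remove f₂ c
  eq₁ : count f₁ ≡ 2
  eq₁ = suc-injective (trans (sym (count-remove f fa)) eq)
  b∈₁ : f₁ b ≡ true
  b∈₁ = trans (remove-other f (a≢b ∘ sym)) fb
  eq₂ : count f₂ ≡ 1
  eq₂ = suc-injective (trans (sym (count-remove f₁ b∈₁)) eq₁)
  c∈₂ : f₂ c ≡ true
  c∈₂ = trans (remove-other f₁ (b≢c ∘ sym)) (trans (remove-other f (a≢c ∘ sym)) fc)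
  eq₃ : count f₃ ≡ 0
  eq₃ = suc-injective (trans (sym (count-remove f₂ c∈₂)) eq₂)
  d∈₃ : 0 < count f₃
  d∈₃ = count-pos f₃ (trans (remove-other f₂ (c≢d ∘ sym))
          (trans (remove-other f₁ (b≢d ∘ sym)) (trans (remove-other f (a≢d ∘ sym)) fd)))

lexicographic : ∀ {a a′ b b′ B} → b < B → a < a′ → a * B + b < a′ * B + b′
lexicographic {a} {a′} {b} {b′} {B} b<B a<a′ = begin-strict
  a * B + b   <⟨ +-monoʳ-< (a * B) b<B ⟩
  a * B + B   ≡⟨ +-comm (a * B) B ⟩
  suc a * B   ≤⟨ *-monoˡ-≤ B a<a′ ⟩
  a′ * B      ≤⟨ m≤m+n (a′ * B) b′ ⟩
  a′ * B + b′ ∎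
  where open ≤-Reasoning

does-true : ∀ {A : Set} (a? : Dec A) → does a? ≡ true → A
does-true (yes a) _ = a

Maximisable : Set → Set
Maximisable A = (S : A → ℕ) → ∃ λ a → ∀ b → S b ≤ S a

larger : ∀ {A : Set} (S : A → ℕ) (a b : A) → ∃ λ c → S a ≤ S c × S b ≤ S c
larger S a b with S a ≤? S b
... | yes a≤b = b , a≤b , ≤-refl
... | no  a≰b = a , ≤-refl , ≰⇒≥ a≰b

maximisable-Maybe : ∀ {A} → Maximisable A → Maximisable (Maybe A)
maximisable-Maybe maxA S with maxA (S ∘ just)
... | a , a-best with larger S nothing (just a)
... | c , nothing≤c , a≤c = c , bound
  where
  bound : ∀ b → S b ≤ S c
  bound nothing  = nothing≤c
  bound (just b) = ≤-trans (a-best b) a≤c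

-- Functions Fin k → A, compared through a function S that respects pointwise
-- equality, are maximised coordinate by coordinate.
maximise-functions : ∀ {A} → Maximisable A → ∀ k (S : (Fin k → A) → ℕ) →
  (∀ {f g} → f ≗ g → S f ≡ S g) → ∃ λ f → ∀ g → S g ≤ S f
maximise-functions maxA zero    S S-cong = (λ ()) , λ g → ≤-reflexive (S-cong (λ ()))
maximise-functions {A} maxA (suc k) S S-cong = head ∷ᶠ tail head , bound
  where
  best-tail : ∀ a → ∃ λ t → ∀ t′ → S (a ∷ᶠ t′) ≤ S (a ∷ᶠ t)
  best-tail a = maximise-functions maxA k (λ t → S (a ∷ᶠ t)) λ eq → S-cong λ { zero → refl ; (suc i) → eq i }
  tail : A → Fin k → A
  tail a = proj₁ (best-tail a)
  best-head : ∃ λ a → ∀ b → S (b ∷ᶠ tail b) ≤ S (a ∷ᶠ tail a)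
  best-head = maxA λ a → S (a ∷ᶠ tail a)
  head : A
  head = proj₁ best-head
  bound : ∀ g → S g ≤ S (head ∷ᶠ tail head)
  bound g = begin
    S g                          ≡⟨ S-cong (λ { zero → refl ; (suc i) → refl }) ⟩
    S (g zero ∷ᶠ (g ∘ suc))      ≤⟨ proj₂ (best-tail (g zero)) (g ∘ suc) ⟩
    S (g zero ∷ᶠ tail (g zero))  ≤⟨ proj₂ best-head (g zero) ⟩
    S (head ∷ᶠ tail head)        ∎
    where open ≤-Reasoning

module Endpoints (G : Graph) where

  Vertex Edge : Set
  Vertex = Fin (n G)
  Edge   = Fin (m G)

  infix 4 _∈ᵉ_
  _∈ᵉ_ : Vertex → Edge → Set
  v ∈ᵉ e = incident G v e

  incidence : Vertex → Edge → Bool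
  incidence v e = ⌊ v ≟ proj₁ (ends G e) ⌋ ∨ ⌊ v ≟ proj₂ (ends G e) ⌋

  incidence-sound : ∀ v {e} → incidence v e ≡ true → v ∈ᵉ e
  incidence-sound v {e} p with v ≟ proj₁ (ends G e) | v ≟ proj₂ (ends G e)
  ... | yes v≡₁ | _       = inj₁ v≡₁
  ... | no _    | yes v≡₂ = inj₂ v≡₂

  incidence-complete : ∀ {v e} → v ∈ᵉ e → incidence v e ≡ true
  incidence-complete {v} {e} v∈e with v ≟ proj₁ (ends G e) | v ≟ proj₂ (ends G e) | v∈e
  ... | yes _ | _     | _      = refl
  ... | no _  | yes _ | _      = refl
  ... | no ≢₁ | no _  | inj₁ ≡₁ with () ← ≢₁ ≡₁
  ... | no _  | no ≢₂ | inj₂ ≡₂ with () ← ≢₂ ≡₂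

  incident? : ∀ v e → Dec (v ∈ᵉ e)
  incident? v e = map′ (incidence-sound v) incidence-complete (incidence v e ≟ᵇ true)

  degree≡count : ∀ v → degree G v ≡ count (incidence v)
  degree≡count v = trans (∣∣≡count (incidentEdges G v)) (count-cong (lookup∘tabulate (incidence v)))

  other : Vertex → Edge → Vertex
  other v e with v ≟ proj₁ (ends G e)
  ... | yes _ = proj₂ (ends G e)
  ... | no _  = proj₁ (ends G e)

  other-∈ : ∀ v e → other v e ∈ᵉ e
  other-∈ v e with v ≟ proj₁ (ends G e)
  ... | yes _ = inj₂ refl
  ... | no _  = inj₁ refl

  other-≢ : ∀ {v e} → v ∈ᵉ e → other v e ≢ v
  other-≢ {v} {e} v∈e with v ≟ proj₁ (ends G e) | v∈e
  ... | yes v≡₁ | _       = λ o≡v → noLoop G e (trans (sym v≡₁) (sym o≡v))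
  ... | no v≢₁  | inj₁ v≡₁ with () ← v≢₁ v≡₁
  ... | no _    | inj₂ v≡₂ = λ o≡v → noLoop G e (trans o≡v v≡₂)

  endpoint-other : ∀ {v w e} → v ∈ᵉ e → w ∈ᵉ e → w ≢ v → w ≡ other v e
  endpoint-other {v} {w} {e} v∈e w∈e w≢v with v ≟ proj₁ (ends G e) | v∈e | w∈e
  ... | yes v≡₁ | _        | inj₁ w≡₁ with () ← w≢v (trans w≡₁ (sym v≡₁))
  ... | yes _   | _        | inj₂ w≡₂ = w≡₂
  ... | no _    | _        | inj₁ w≡₁ = w≡₁
  ... | no v≢₁  | inj₁ v≡₁ | inj₂ _ with () ← v≢₁ v≡₁
  ... | no _    | inj₂ v≡₂ | inj₂ w≡₂ with () ← w≢v (trans w≡₂ (sym v≡₂))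

  endpoints : ∀ {v w e} → v ∈ᵉ e → w ∈ᵉ e → w ≡ v ⊎ w ≡ other v e
  endpoints {v} {w} v∈e w∈e with w ≟ v
  ... | yes w≡v = inj₁ w≡v
  ... | no w≢v  = inj₂ (endpoint-other v∈e w∈e w≢v)

  other-other : ∀ {v e} → v ∈ᵉ e → other (other v e) e ≡ v
  other-other {v} {e} v∈e = sym (endpoint-other (other-∈ v e) v∈e (other-≢ v∈e ∘ sym))

data Colour : Set where
  red blue : Colour

opposite : Colour → Colour
opposite red  = blue
opposite blue = red

opposite-≢ : ∀ κ → opposite κ ≢ κ
opposite-≢ red  ()
opposite-≢ blue ()

not-κ-is-opposite : ∀ {κ μ} → μ ≢ κ → μ ≡ opposite κ
not-κ-is-opposite {red}  {red}  μ≢κ with () ← μ≢κ refl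
not-κ-is-opposite {red}  {blue} _   = refl
not-κ-is-opposite {blue} {red}  _   = refl
not-κ-is-opposite {blue} {blue} μ≢κ with () ← μ≢κ refl

colour-pigeonhole : ∀ (κ₁ κ₂ κ₃ : Colour) → κ₁ ≡ κ₂ ⊎ κ₁ ≡ κ₃ ⊎ κ₂ ≡ κ₃
colour-pigeonhole red  red  _    = inj₁ refl
colour-pigeonhole blue blue _    = inj₁ refl
colour-pigeonhole red  blue red  = inj₂ (inj₁ refl)
colour-pigeonhole red  blue blue = inj₂ (inj₂ refl)
colour-pigeonhole blue red  red  = inj₂ (inj₂ refl)
colour-pigeonhole blue red  blue = inj₂ (inj₁ refl)

_≟ᶜ_ : (κ μ : Colour) → Dec (κ ≡ μ)
red  ≟ᶜ red  = yes refl
red  ≟ᶜ blue = no λ ()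
blue ≟ᶜ red  = no λ ()
blue ≟ᶜ blue = yes refl

all-colours? : ∀ {P : Colour → Set} → (∀ κ → Dec (P κ)) → Dec (∀ κ → P κ)
all-colours? P? = map′ (λ { (r , b) red → r ; (r , b) blue → b }) (λ all → all red , all blue)
                       (P? red ×-dec P? blue)

maximisable-Colour : Maximisable Colour
maximisable-Colour S with larger S red blue
... | κ , red≤κ , blue≤κ = κ , λ { red → red≤κ ; blue → blue≤κ }

_≟ᵐ_ : (x y : Maybe Colour) → Dec (x ≡ y)
_≟ᵐ_ = Maybe.≡-dec _≟ᶜ_

Coloured : Maybe Colour → Set
Coloured x = ∃ λ κ → x ≡ just κ

coloured? : ∀ x → Dec (Coloured x)
coloured? (just κ) = yes (κ , refl)
coloured? nothing  = no λ ()

module PartialColourings (G : Graph) where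
  open Endpoints G

  Colouring : Set
  Colouring = Edge → Maybe Colour

  Proper : Colouring → Set
  Proper c = ∀ {z h h′ κ} → z ∈ᵉ h → z ∈ᵉ h′ → c h ≡ just κ → c h′ ≡ just κ → h ≡ h′

  -- Recolouring the single edge e with x.  Kept opaque: it is used only
  -- through paint-at and paint-elsewhere, so case analyses on edges elsewhere
  -- never unfold it.
  opaque
    _[_≔_] : Colouring → Edge → Maybe Colour → Colouring
    (c [ e ≔ x ]) h = if ⌊ h ≟ e ⌋ then x else c h

    paint-at : ∀ c e x → (c [ e ≔ x ]) e ≡ x
    paint-at c e x with e ≟ e
    ... | yes _   = refl
    ... | no e≢e with () ← e≢e refl

    paint-elsewhere : ∀ c {e h} x → h ≢ e → (c [ e ≔ x ]) h ≡ c h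
    paint-elsewhere c {e} {h} x h≢e with h ≟ e
    ... | yes h≡e with () ← h≢e h≡e
    ... | no _    = refl

  painted-at : ∀ c {e x y} → (c [ e ≔ x ]) e ≡ y → x ≡ y
  painted-at c {e} {x} = trans (sym (paint-at c e x))

  painted-elsewhere : ∀ c {e h x y} → h ≢ e → (c [ e ≔ x ]) h ≡ y → c h ≡ y
  painted-elsewhere c {x = x} h≢e = trans (sym (paint-elsewhere c x h≢e))

  proper-paint : ∀ {c e x} → Proper c →
    (∀ {z h κ} → x ≡ just κ → z ∈ᵉ e → z ∈ᵉ h → c h ≡ just κ → h ≡ e) → Proper (c [ e ≔ x ])
  proper-paint {c} {e} {x} proper fresh {z} {h} {h′} z∈h z∈h′ ch ch′ with h ≟ e | h′ ≟ e
  ... | yes h≡e  | yes h′≡e = trans h≡e (sym h′≡e)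
  ... | yes refl | no h′≢e  = sym (fresh (painted-at c ch) z∈h z∈h′ (painted-elsewhere c h′≢e ch′))
  ... | no h≢e   | yes refl = fresh (painted-at c ch′) z∈h′ z∈h (painted-elsewhere c h≢e ch)
  ... | no h≢e   | no h′≢e  = proper z∈h z∈h′ (painted-elsewhere c h≢e ch) (painted-elsewhere c h′≢e ch′)

  proper-erase : ∀ {c} e → Proper c → Proper (c [ e ≔ nothing ])
  proper-erase e proper = proper-paint proper λ ()

  Covered : Colouring → Vertex → Set
  Covered c z = ∃ λ h → z ∈ᵉ h × Coloured (c h)

  Uncovered : Colouring → Vertex → Set
  Uncovered c z = ∀ {h} → z ∈ᵉ h → c h ≡ nothing

  covered? : ∀ c z → Dec (Covered c z)
  covered? c z = any? λ h → incident? z h ×-dec coloured? (c h)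

  uncovered : ∀ {c z} → ¬ Covered c z → Uncovered c z
  uncovered {c} {z} ¬cov {h} z∈h with c h in ch
  ... | nothing = refl
  ... | just κ with () ← ¬cov (h , z∈h , κ , ch)

  Saturated : Colouring → Vertex → Set
  Saturated c y = ∀ κ → ∃ λ f → y ∈ᵉ f × c f ≡ just κ

  -- A colouring is valued first by its number of coloured edges, then by
  -- its number of covered vertices.
  size coverage weight : Colouring → ℕ
  size c     = count (is-just ∘ c)
  coverage c = count (λ z → does (covered? c z))
  weight c   = size c * suc (n G) + coverage c

  Optimal : Colouring → Set
  Optimal c = Proper c × (∀ c′ → Proper c′ → weight c′ ≤ weight c)

  weight-size : ∀ {c c′} → size c < size c′ → weight c < weight c′
  weight-size {c} = lexicographic (s≤s (count-≤ (λ z → does (covered? c z))))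

  size-bound : ∀ {c c′} → weight c′ ≤ weight c → size c′ ≤ size c
  size-bound {c} {c′} w≤ with size c′ ≤? size c
  ... | yes s≤ = s≤
  ... | no s≰  with () ← <⇒≱ (weight-size {c} {c′} (≰⇒> s≰)) w≤

  weight-coverage : ∀ {c c′} → size c ≡ size c′ → coverage c ≤ coverage c′ → weight c ≤ weight c′
  weight-coverage {c} {c′} eq cov≤ rewrite eq = +-monoʳ-≤ (size c′ * suc (n G)) cov≤

  weight-coverage< : ∀ {c c′} → size c ≡ size c′ → coverage c < coverage c′ → weight c < weight c′
  weight-coverage< {c} {c′} eq cov< rewrite eq = +-monoʳ-< (size c′ * suc (n G)) cov<

  size-paint : ∀ {c e} κ → c e ≡ nothing → size (c [ e ≔ just κ ]) ≡ suc (size c)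
  size-paint {c} {e} κ ce = count-add (cong is-just ce) (cong is-just (paint-at c e (just κ)))
    λ h h≢e → cong is-just (sym (paint-elsewhere c (just κ) h≢e))

  size-erase : ∀ {c e κ} → c e ≡ just κ → size c ≡ suc (size (c [ e ≔ nothing ]))
  size-erase {c} {e} ce = count-add (cong is-just (paint-at c e nothing)) (cong is-just ce)
    λ h h≢e → cong is-just (paint-elsewhere c nothing h≢e)

  covered-does : ∀ {c z} → does (covered? c z) ≡ true → Covered c z
  covered-does {c} {z} = does-true (covered? c z)

  uncovered-¬covered : ∀ {c z} → Uncovered c z → ¬ Covered c z
  uncovered-¬covered bare (h , z∈h , κ , ch) with () ← trans (sym ch) (bare z∈h)

  coverage-exchange : ∀ {c c′ a v} → (∀ z → z ≢ a → Covered c z → Covered c′ z) →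
    Covered c′ v → Uncovered c v → coverage c ≤ coverage c′
  coverage-exchange {c} {c′} keep cov′ bare =
    count-exchange (λ z z≢a cov → dec-true (covered? c′ z) (keep z z≢a (covered-does cov)))
                   (dec-true (covered? c′ _) cov′) (dec-false (covered? c _) (uncovered-¬covered bare))

  coverage-strict : ∀ {c c′ v} → (∀ z → Covered c z → Covered c′ z) →
    Covered c′ v → Uncovered c v → coverage c < coverage c′
  coverage-strict {c} {c′} keep cov′ bare =
    count-strict (λ z cov → dec-true (covered? c′ z) (keep z (covered-does cov)))
                 (dec-true (covered? c′ _) cov′) (dec-false (covered? c _) (uncovered-¬covered bare))

  proper? : ∀ c → Dec (Proper c)
  proper? c = map′ (λ p z∈h z∈h′ ch ch′ → p _ _ _ _ z∈h z∈h′ ch ch′)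
                   (λ p z h h′ κ z∈h z∈h′ ch ch′ → p z∈h z∈h′ ch ch′)
    (all? λ z → all? λ h → all? λ h′ → all-colours? λ κ →
       incident? z h →-dec (incident? z h′ →-dec
         (c h ≟ᵐ just κ →-dec (c h′ ≟ᵐ just κ →-dec (h ≟ h′)))))

  proper-cong : ∀ {c d} → c ≗ d → Proper c → Proper d
  proper-cong c≗d proper z∈h z∈h′ dh dh′ = proper z∈h z∈h′ (trans (c≗d _) dh) (trans (c≗d _) dh′)

  weight-cong : ∀ {c d} → c ≗ d → weight c ≡ weight d
  weight-cong {c} {d} c≗d = cong₂ (λ s k → s * suc (n G) + k)
    (count-cong (cong is-just ∘ c≗d))
    (count-cong λ z → does-⇔ (mk⇔ (transport c≗d) (transport (sym ∘ c≗d))) (covered? c z) (covered? d z))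
    where
    transport : ∀ {c d z} → c ≗ d → Covered c z → Covered d z
    transport c≗d (h , z∈h , κ , ch) = h , z∈h , κ , trans (sym (c≗d h)) ch

  score : Colouring → ℕ
  score c with proper? c
  ... | yes _ = suc (weight c)
  ... | no _  = 0

  score-proper : ∀ {c} → Proper c → score c ≡ suc (weight c)
  score-proper {c} proper with proper? c
  ... | yes _      = refl
  ... | no improper with () ← improper proper

  score-cong : ∀ {c d} → c ≗ d → score c ≡ score d
  score-cong {c} {d} c≗d with proper? c | proper? d
  ... | yes _ | yes _ = cong suc (weight-cong c≗d)
  ... | no _  | no _  = refl
  ... | yes pc | no ¬pd with () ← ¬pd (proper-cong c≗d pc)
  ... | no ¬pc | yes pd with () ← ¬pc (proper-cong (sym ∘ c≗d) pd)

  score-improper : ∀ {c} → ¬ Proper c → score c ≡ 0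
  score-improper {c} improper with proper? c
  ... | yes proper with () ← improper proper
  ... | no _       = refl

  empty-proper : Proper (λ _ → nothing)
  empty-proper _ _ ()

  best-score-optimal : ∀ {c} → (∀ c′ → score c′ ≤ score c) → Dec (Proper c) → Optimal c
  best-score-optimal best (yes proper) = proper , λ c′ proper′ →
    ≤-pred (subst₂ _≤_ (score-proper proper′) (score-proper proper) (best c′))
  best-score-optimal best (no improper)
    with () ← subst₂ _≤_ (score-proper empty-proper) (score-improper improper) (best _)

  -- There are finitely many colourings, so an optimal one exists.
  optimal-exists : ∃ Optimal
  optimal-exists =
    let c , best = maximise-functions (maximisable-Maybe maximisable-Colour) (m G) score score-cong
    in c , best-score-optimal best (proper? c)

  -- In an optimal colouring each neighbour y of an uncovered vertex v is
  -- saturated: a colour missing at y could be given to the edge vy.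
  augment : ∀ {c v e} → Optimal c → Uncovered c v → v ∈ᵉ e → Saturated c (other v e)
  augment {c} {v} {e} (proper , maximal) bare v∈e κ
    with any? (λ f → incident? (other v e) f ×-dec c f ≟ᵐ just κ)
  ... | yes (f , y∈f , cf) = f , y∈f , cf
  ... | no missing = ⊥-elim (<⇒≱ (weight-size (≤-reflexive (sym (size-paint κ (bare v∈e)))))
                                  (maximal _ (proper-paint proper fresh)))
    where
    fresh : ∀ {z h μ} → just κ ≡ just μ → z ∈ᵉ e → z ∈ᵉ h → c h ≡ just μ → h ≡ e
    fresh refl z∈e z∈h ch with endpoints v∈e z∈e
    ... | inj₁ refl with () ← trans (sym ch) (bare z∈h)
    ... | inj₂ refl with () ← missing (_ , z∈h , ch)

  -- Rotation at an uncovered vertex v: for an edge e = vy and the κ-edge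
  -- f = ya at y, move colour κ from f to e.
  module Rotation {c} (proper : Proper c) {v} (bare : Uncovered c v) {e} (v∈e : v ∈ᵉ e)
                  {f κ} (y∈f : other v e ∈ᵉ f) (cf : c f ≡ just κ) where

    y a : Vertex
    y = other v e
    a = other y f

    erased rotated : Colouring
    erased  = c [ f ≔ nothing ]
    rotated = erased [ e ≔ just κ ]

    ce : c e ≡ nothing
    ce = bare v∈e

    coloured-≢e : ∀ {h μ} → c h ≡ just μ → h ≢ e
    coloured-≢e ch refl with () ← trans (sym ch) ce

    rotated-e : rotated e ≡ just κ
    rotated-e = paint-at erased e (just κ)

    rotated-f : rotated f ≡ nothing
    rotated-f = trans (paint-elsewhere erased (just κ) (coloured-≢e cf)) (paint-at c f nothing)

    rotated-elsewhere : ∀ {h} → h ≢ e → h ≢ f → rotated h ≡ c h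
    rotated-elsewhere h≢e h≢f = trans (paint-elsewhere erased (just κ) h≢e) (paint-elsewhere c nothing h≢f)

    erased-coloured : ∀ {h μ} → erased h ≡ just μ → h ≢ f × c h ≡ just μ
    erased-coloured {h} eh with h ≟ f
    ... | yes refl with () ← painted-at c eh
    ... | no h≢f  = h≢f , painted-elsewhere c h≢f eh

    -- e receives κ: no edge at v is coloured, and f was the only κ-edge at y
    rotated-proper : Proper rotated
    rotated-proper = proper-paint (proper-erase f proper) fresh
      where
      fresh : ∀ {z h μ} → just κ ≡ just μ → z ∈ᵉ e → z ∈ᵉ h → erased h ≡ just μ → h ≡ e
      fresh refl z∈e z∈h eh with erased-coloured eh | endpoints v∈e z∈e
      ... | _   , ch | inj₁ refl with () ← trans (sym ch) (bare z∈h)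
      ... | h≢f , ch | inj₂ refl with () ← h≢f (proper z∈h y∈f ch cf)

    -- one edge loses its colour and one gains it
    rotated-size : size rotated ≡ size c
    rotated-size = trans (size-paint κ (trans (paint-elsewhere c nothing (coloured-≢e cf ∘ sym)) ce))
                         (sym (size-erase cf))

    keeps-cover : ∀ z → z ≢ a → Covered c z → Covered rotated z
    keeps-cover z z≢a (h , z∈h , μ , ch) with h ≟ f
    ... | no h≢f  = h , z∈h , μ , trans (rotated-elsewhere (coloured-≢e ch) h≢f) ch
    ... | yes refl with endpoints y∈f z∈h
    ...   | inj₁ refl = e , other-∈ v e , κ , rotated-e
    ...   | inj₂ z≡a  with () ← z≢a z≡a

    covers-v : Covered rotated v
    covers-v = e , v∈e , κ , rotated-e

    rotated-coloured : ∀ {h μ} → h ≢ e → rotated h ≡ just μ → c h ≡ just μ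
    rotated-coloured {h} h≢e rh with h ≟ f
    ... | yes refl with () ← trans (sym rh) rotated-f
    ... | no h≢f   = trans (sym (rotated-elsewhere h≢e h≢f)) rh

    v-lacks-opposite : ∀ {g} → v ∈ᵉ g → rotated g ≢ just (opposite κ)
    v-lacks-opposite {g} v∈g rg with g ≟ e
    ... | yes refl = opposite-≢ κ (just-injective (trans (sym rg) rotated-e))
    ... | no g≢e   with () ← trans (sym (rotated-coloured g≢e rg)) (bare v∈g)

    a∈f : a ∈ᵉ f
    a∈f = other-∈ y f

    -- a is not an endpoint of e: it is neither y nor the uncovered v
    far-end-∉e : ¬ a ∈ᵉ e
    far-end-∉e a∈e with endpoints v∈e a∈e
    ... | inj₁ a≡v with () ← trans (sym cf) (bare (subst (_∈ᵉ f) a≡v a∈f))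
    ... | inj₂ a≡y = other-≢ y∈f a≡y

    rotated-weight : weight c ≤ weight rotated
    rotated-weight = weight-coverage (sym rotated-size) (coverage-exchange keeps-cover covers-v bare)

    module _ (maximal : ∀ c′ → Proper c′ → weight c′ ≤ weight c) where

      rotated-optimal : Optimal rotated
      rotated-optimal = rotated-proper , λ c′ proper′ → ≤-trans (maximal c′ proper′) rotated-weight

      -- a has no edge of the opposite colour, for otherwise the rotation
      -- would cover strictly more vertices
      far-end-lacks : ∀ {h} → a ∈ᵉ h → c h ≢ just (opposite κ)
      far-end-lacks {h} a∈h ch = <⇒≱ (weight-coverage< (sym rotated-size) (coverage-strict keeps-all covers-v bare))
                                     (maximal rotated rotated-proper)
        where
        h≢f : h ≢ f
        h≢f refl = opposite-≢ κ (just-injective (trans (sym ch) cf))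
        keeps-all : ∀ z → Covered c z → Covered rotated z
        keeps-all z cov with z ≟ a
        ... | yes refl = h , a∈h , opposite κ , trans (rotated-elsewhere (coloured-≢e ch) h≢f) ch
        ... | no z≢a   = keeps-cover z z≢a cov

      far-end-uncovered : Uncovered rotated a
      far-end-uncovered {h} a∈h with rotated h in rh
      ... | nothing = refl
      ... | just μ with h ≟ e
      ...   | yes refl = ⊥-elim (far-end-∉e a∈h)
      ...   | no h≢e with μ ≟ᶜ κ
      ...     | yes refl
                with () ← trans (sym rh) (trans (cong rotated (proper a∈h a∈f (rotated-coloured h≢e rh) cf)) rotated-f)
      ...     | no μ≢κ =
                ⊥-elim (far-end-lacks a∈h (trans (rotated-coloured h≢e rh) (cong just (not-κ-is-opposite μ≢κ))))

    -- saturation in the rotated colouring implies saturation in c: the only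
    -- newly coloured edge is e, whose colour κ was on f at y, while v cannot
    -- be saturated after the rotation
    unrotate-saturated : ∀ {w} → Saturated rotated w → Saturated c w
    unrotate-saturated {w} sat μ with sat μ
    ... | g , w∈g , rg with g ≟ e
    ...   | no g≢e = g , w∈g , rotated-coloured g≢e rg
    ...   | yes refl with just-injective (trans (sym rotated-e) rg) | endpoints v∈e w∈g
    ...     | refl | inj₂ refl = f , y∈f , cf
    ...     | refl | inj₁ refl =
              ⊥-elim (let g′ , v∈g′ , rg′ = sat (opposite κ) in v-lacks-opposite v∈g′ rg′)

module CubicColourings (G : Graph) (cubic : Cubic G) where
  open Endpoints G
  open PartialColourings G

  three-edges : ∀ v → count (incidence v) ≡ 3
  three-edges v = trans (sym (degree≡count v)) (cubic v)

  -- A saturated vertex, which carries a red and a blue edge, has at most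
  -- one uncoloured edge.
  uncoloured-unique : ∀ {c y h h′} → Saturated c y → y ∈ᵉ h → y ∈ᵉ h′ →
                      c h ≡ nothing → c h′ ≡ nothing → h ≡ h′
  uncoloured-unique {c} {y} {h} {h′} sat y∈h y∈h′ ch ch′ with h ≟ h′ | sat red | sat blue
  ... | yes h≡h′ | _ | _ = h≡h′
  ... | no h≢h′ | r , y∈r , cr | b , y∈b , cb = ⊥-elim (noFourMembers (incidence y) (three-edges y)
          (incidence-complete y∈r) (incidence-complete y∈b) (incidence-complete y∈h) (incidence-complete y∈h′)
          (differ cr cb λ ()) (differ cr ch λ ()) (differ cr ch′ λ ())
          (differ cb ch λ ()) (differ cb ch′ λ ()) h≢h′)
    where
    differ : ∀ {g g′ x x′} → c g ≡ x → c g′ ≡ x′ → x ≢ x′ → g ≢ g′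
    differ cg cg′ x≢x′ refl = x≢x′ (trans (sym cg) cg′)

  -- In a proper colouring every vertex has an uncoloured edge: of its
  -- three edges two would otherwise share a colour.
  uncoloured-edge : ∀ {c} → Proper c → ∀ x → ∃ λ h → x ∈ᵉ h × c h ≡ nothing
  uncoloured-edge {c} proper x = pick (threeMembers (incidence x) (three-edges x))
    where
    clash : ∀ {g g′ κ} → incidence x g ≡ true → incidence x g′ ≡ true →
            c g ≡ just κ → c g′ ≡ just κ → g ≡ g′
    clash x∈g x∈g′ = proper (incidence-sound x x∈g) (incidence-sound x x∈g′)
    pick : ThreeMembers (incidence x) → ∃ λ h → x ∈ᵉ h × c h ≡ nothing
    pick record { i₁ = e₁ ; i₂ = e₂ ; i₃ = e₃ ; i₁∈ = x∈₁ ; i₂∈ = x∈₂ ; i₃∈ = x∈₃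
                ; i₁≢i₂ = e₁≢e₂ ; i₁≢i₃ = e₁≢e₃ ; i₂≢i₃ = e₂≢e₃ }
      with c e₁ in c₁ | c e₂ in c₂ | c e₃ in c₃
    ... | nothing | _       | _       = e₁ , incidence-sound x x∈₁ , c₁
    ... | just _  | nothing | _       = e₂ , incidence-sound x x∈₂ , c₂
    ... | just _  | just _  | nothing = e₃ , incidence-sound x x∈₃ , c₃
    ... | just κ₁ | just κ₂ | just κ₃ with colour-pigeonhole κ₁ κ₂ κ₃
    ...   | inj₁ refl        = ⊥-elim (e₁≢e₂ (clash x∈₁ x∈₂ c₁ c₂))
    ...   | inj₂ (inj₁ refl) = ⊥-elim (e₁≢e₃ (clash x∈₁ x∈₃ c₁ c₃))
    ...   | inj₂ (inj₂ refl) = ⊥-elim (e₂≢e₃ (clash x∈₂ x∈₃ c₂ c₃))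

  Neighbour : Vertex → Vertex → Set
  Neighbour x y = ∃ λ h → x ∈ᵉ h × y ≡ other x h

  TwoStep : Vertex → Vertex → Set
  TwoStep x z = ∃ λ y → Neighbour x y × Neighbour y z

  NeighboursSaturated : Colouring → Vertex → Set
  NeighboursSaturated c x = ∀ {y} → Neighbour x y → Saturated c y

  -- Induction on the walk, whose first two steps go v → y → x₁:
  -- if they return to v we continue from v; otherwise the edge yx₁ is
  -- coloured (y has just one uncoloured edge), the rotation along it is again
  -- optimal with x₁ uncovered, and saturation transfers back.
  even-walk-saturated : ∀ {v x} → Star TwoStep v x →
                        ∀ {c} → Optimal c → Uncovered c v → NeighboursSaturated c x
  even-walk-saturated ε optimal bare (h , v∈h , refl) = augment optimal bare v∈h
  even-walk-saturated {v} ((_ , (e , v∈e , refl) , (h , y∈h , refl)) ◅ walk) {c} optimal@(proper , maximal) bare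
    with c h in ch
  ... | nothing = even-walk-saturated walk optimal (subst (Uncovered c) (sym back) bare)
    where
    h≡e : h ≡ e
    h≡e = uncoloured-unique (augment optimal bare v∈e) y∈h (other-∈ v e) ch (bare v∈e)
    back : other (other v e) h ≡ v
    back = trans (cong (other (other v e)) h≡e) (other-other v∈e)
  ... | just κ = λ neighbour →
          unrotate-saturated (even-walk-saturated walk (rotated-optimal maximal) (far-end-uncovered maximal) neighbour)
    where open Rotation proper bare v∈e y∈h ch

  record Hop (c : Colouring) (x z : Vertex) : Set where
    field
      e f : Edge
      x∈e : x ∈ᵉ e
      e-uncoloured : c e ≡ nothing
      y∈f : other x e ∈ᵉ f
      f-red : c f ≡ just red
      z≡ : z ≡ other (other x e) f

  hop-exists : ∀ {c x} → Proper c → NeighboursSaturated c x → ∃ (Hop c x)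
  hop-exists {c} {x} proper sat-nbrs with uncoloured-edge proper x
  ... | e , x∈e , ce with sat-nbrs (e , x∈e , refl) red
  ... | f , y∈f , cf = _ , record { e = e ; f = f ; x∈e = x∈e ; e-uncoloured = ce ; y∈f = y∈f
                                  ; f-red = cf ; z≡ = refl }

  hop-step : ∀ {c x z} → Hop c x z → TwoStep x z
  hop-step hop = _ , (e , x∈e , refl) , (f , y∈f , z≡)
    where open Hop hop

  hop-covered : ∀ {c x z} → Hop c x z → Covered c z
  hop-covered {x = x} hop = f , subst (_∈ᵉ f) (sym z≡) (other-∈ (other x e) f) , red , f-red
    where open Hop hop

  -- The end of a hop determines its start: the red edge at z, then the
  -- middle vertex, then (by uniqueness of its uncoloured edge) the start.
  hop-injective : ∀ {c x x′ z} → Proper c → NeighboursSaturated c x → Hop c x z → Hop c x′ z → x ≡ x′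
  hop-injective {c} {x} {x′} {z} proper sat-nbrs hop hop′ = begin
    x                      ≡⟨ other-other x∈e ⟨
    other (other x e) e    ≡⟨ cong₂ other y≡y′ e≡e′ ⟩
    other (other x′ e′) e′ ≡⟨ other-other x′∈e′ ⟩
    x′                     ∎
    where
    open ≡-Reasoning
    open Hop hop
    open Hop hop′ renaming (e to e′; f to f′; x∈e to x′∈e′; e-uncoloured to e′-uncoloured;
                            y∈f to y′∈f′; f-red to f′-red; z≡ to z≡′)
    middle : ∀ {x e f} → other x e ∈ᵉ f → z ≡ other (other x e) f → other x e ≡ other z f
    middle {x} {e} {f} y∈f z≡ = trans (sym (other-other {other x e} y∈f)) (cong (λ u → other u f) (sym z≡))
    f≡f′ : f ≡ f′
    f≡f′ = proper (subst (_∈ᵉ f) (sym z≡) (other-∈ (other x e) f))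
                  (subst (_∈ᵉ f′) (sym z≡′) (other-∈ (other x′ e′) f′)) f-red f′-red
    y≡y′ : other x e ≡ other x′ e′
    y≡y′ = trans (middle {x} y∈f z≡) (trans (cong (other z) f≡f′) (sym (middle {x′} y′∈f′ z≡′)))
    e≡e′ : e ≡ e′
    e≡e′ = uncoloured-unique (sat-nbrs (e , x∈e , refl)) (other-∈ x e)
             (subst (_∈ᵉ e′) (sym y≡y′) (other-∈ x′ e′)) e-uncoloured e′-uncoloured

  -- From an uncovered vertex v, iterated hops give n + 1 pairwise distinct
  -- vertices, which is impossible.
  module NoUncoveredVertex {c} (optimal : Optimal c) {v} (bare : Uncovered c v) where

    proper : Proper c
    proper = proj₁ optimal

    walk : ℕ → ∃ (Star TwoStep v)
    walk zero    = v , ε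
    walk (suc i) = let x , path = walk i
                       z , hop  = hop-exists proper (even-walk-saturated path optimal bare)
                   in z , path ◅◅ hop-step hop ◅ ε

    position : ℕ → Vertex
    position i = proj₁ (walk i)

    saturated-at : ∀ i → NeighboursSaturated c (position i)
    saturated-at i = even-walk-saturated (proj₂ (walk i)) optimal bare

    hop-at : ∀ i → Hop c (position i) (position (suc i))
    hop-at i = proj₂ (hop-exists proper (saturated-at i))

    -- the walk never returns to v, since the ends of hops are covered
    start-not-revisited : ∀ j → v ≢ position (suc j)
    start-not-revisited j v≡ = uncovered-¬covered bare (subst (Covered c) (sym v≡) (hop-covered (hop-at j)))

    position-injective : ∀ i j → position i ≡ position j → i ≡ j
    position-injective zero    zero    _ = refl
    position-injective zero    (suc j) p = ⊥-elim (start-not-revisited j p)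
    position-injective (suc i) zero    p = ⊥-elim (start-not-revisited i (sym p))
    position-injective (suc i) (suc j) p = cong suc (position-injective i j
      (hop-injective proper (saturated-at i) (hop-at i) (subst (Hop c (position j)) (sym p) (hop-at j))))

    absurd : ⊥
    absurd with pigeonhole (n<1+n (n G)) (position ∘ toℕ)
    ... | i , j , i<j , same = <⇒≢ i<j (toℕ-injective (position-injective (toℕ i) (toℕ j) same))

  optimal-covers : ∀ {c} → Optimal c → ∀ v → Covered c v
  optimal-covers {c} optimal v with covered? c v
  ... | yes covered = covered
  ... | no ¬covered = ⊥-elim (NoUncoveredVertex.absurd optimal (uncovered ¬covered))

∈-tabulate⁺ : ∀ {k} {f : Fin k → Bool} {i} → f i ≡ true → i ∈ tabulate f
∈-tabulate⁺ {f = f} {i} fi = lookup⇒[]= i (tabulate f) (trans (lookup∘tabulate f i) fi)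

∈-tabulate⁻ : ∀ {k} {f : Fin k → Bool} {i} → i ∈ tabulate f → f i ≡ true
∈-tabulate⁻ {f = f} {i} i∈ = trans (sym (lookup∘tabulate f i)) ([]=⇒lookup i∈)

module Subgraphs (G : Graph) where
  open PartialColourings G

  colouredEdges : Colouring → Subset (m G)
  colouredEdges c = tabulate (is-just ∘ c)

  colourClass : Colouring → Colour → Subset (m G)
  colourClass c κ = tabulate λ e → does (c e ≟ᵐ just κ)

  ∣colouredEdges∣ : ∀ c → ∣ colouredEdges c ∣ ≡ size c
  ∣colouredEdges∣ c = trans (∣∣≡count (colouredEdges c)) (count-cong (lookup∘tabulate (is-just ∘ c)))

  colourClass-member : ∀ c {κ e} → e ∈ colourClass c κ → c e ≡ just κ
  colourClass-member c {κ} {e} = does-true (c e ≟ᵐ just κ) ∘ ∈-tabulate⁻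

  colourClass-matching : ∀ {c} → Proper c → ∀ κ → IsMatching G (colourClass c κ)
  colourClass-matching {c} proper κ e f e∈ f∈ e≢f (z , z∈e , z∈f) =
    e≢f (proper z∈e z∈f (colourClass-member c e∈) (colourClass-member c f∈))

  proper-twoColourable : ∀ {c} → Proper c → TwoEdgeColorable G (colouredEdges c)
  proper-twoColourable {c} proper =
    colourClass c red , colourClass c blue ,
    colourClass-matching proper red , colourClass-matching proper blue ,
    split , coloured red , coloured blue
    where
    split : ∀ e → e ∈ colouredEdges c → e ∈ colourClass c red ⊎ e ∈ colourClass c blue
    split e e∈ with c e in ce | ∈-tabulate⁻ e∈
    ... | just red  | _ = inj₁ (∈-tabulate⁺ (dec-true (c e ≟ᵐ just red) ce))
    ... | just blue | _ = inj₂ (∈-tabulate⁺ (dec-true (c e ≟ᵐ just blue) ce))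
    coloured : ∀ κ e → e ∈ colourClass c κ → e ∈ colouredEdges c
    coloured κ e e∈ = ∈-tabulate⁺ (cong is-just (colourClass-member c e∈))

  matchingColouring : Subset (m G) → Subset (m G) → Colouring
  matchingColouring M₁ M₂ e with e ∈? M₁ | e ∈? M₂
  ... | yes _ | _     = just red
  ... | no _  | yes _ = just blue
  ... | no _  | no _  = nothing

  matchingOf : Subset (m G) → Subset (m G) → Colour → Subset (m G)
  matchingOf M₁ M₂ red  = M₁
  matchingOf M₁ M₂ blue = M₂

  matchingColouring-class : ∀ {M₁ M₂ e κ} → matchingColouring M₁ M₂ e ≡ just κ →
                            e ∈ matchingOf M₁ M₂ κ
  matchingColouring-class {M₁} {M₂} {e} eq with e ∈? M₁ | e ∈? M₂ | eq
  ... | yes e∈₁ | _       | refl = e∈₁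
  ... | no _    | yes e∈₂ | refl = e∈₂

  matchingColouring-coloured : ∀ {M₁ M₂ e} → e ∈ M₁ ⊎ e ∈ M₂ →
                               is-just (matchingColouring M₁ M₂ e) ≡ true
  matchingColouring-coloured {M₁} {M₂} {e} e∈ with e ∈? M₁ | e ∈? M₂ | e∈
  ... | yes _ | _     | _       = refl
  ... | no _  | yes _ | _       = refl
  ... | no ∉₁ | no _  | inj₁ ∈₁ with () ← ∉₁ ∈₁
  ... | no _  | no ∉₂ | inj₂ ∈₂ with () ← ∉₂ ∈₂

  matchingColouring-proper : ∀ {M₁ M₂} → IsMatching G M₁ → IsMatching G M₂ →
                             Proper (matchingColouring M₁ M₂)
  matchingColouring-proper {M₁} {M₂} match₁ match₂ {z} {h} {h′} {κ} z∈h z∈h′ ch ch′ with h ≟ h′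
  ... | yes h≡h′ = h≡h′
  ... | no h≢h′  = ⊥-elim (matching κ h h′ (matchingColouring-class ch) (matchingColouring-class ch′)
                                   h≢h′ (z , z∈h , z∈h′))
    where
    matching : ∀ κ → IsMatching G (matchingOf M₁ M₂ κ)
    matching red  = match₁
    matching blue = match₂

  twoColourable-size : ∀ {H} → TwoEdgeColorable G H → ∃ λ c → Proper c × ∣ H ∣ ≤ size c
  twoColourable-size {H} (M₁ , M₂ , match₁ , match₂ , split , _ , _) =
    matchingColouring M₁ M₂ , matchingColouring-proper match₁ match₂ ,
    subst (_≤ _) (sym (∣∣≡count H))
      (count-mono λ e e∈ → matchingColouring-coloured (split e (lookup⇒[]= e H e∈)))

  covering-spanning : ∀ {c} → (∀ v → Covered c v) → Spanning G (colouredEdges c)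
  covering-spanning covers v = let h , v∈h , κ , ch = covers v in h , ∈-tabulate⁺ (cong is-just ch) , v∈h

  optimal-maximum : ∀ {c} → Optimal c → IsMax2EdgeColorable G (colouredEdges c)
  optimal-maximum {c} (proper , maximal) = proper-twoColourable proper , λ H′ twoCol →
    let c′ , proper′ , H′≤c′ = twoColourable-size twoCol
    in ≤-trans H′≤c′ (≤-trans (size-bound (maximal c′ proper′)) (≤-reflexive (sym (∣colouredEdges∣ c))))

mainTheorem13 : (G : Graph) → Cubic G →
    Σ (Subset (m G)) (λ H → IsMax2EdgeColorable G H × Spanning G H)
mainTheorem13 G cubic =
  let c , optimal = optimal-exists
  in colouredEdges c , optimal-maximum optimal , covering-spanning (optimal-covers optimal)
  where
  open PartialColourings G
  open CubicColourings G cubic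
  open Subgraphs G
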